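{- Fix integers $c \geq 0$ and $b \geq 2$, and let $S_{[c,b]}:\mathbb{Z}^+\to\mathbb{Z}^+$ be defined by $S_{[c,b]}\left(\sum_{i=0}^n a_i b^i\right) = c + \sum_{i=0}^n a_i^2$, where $\sum_{i=0}^n a_i b^i$ is the base $b$ expansion ($0 \le a_i \le b-1$, $a_n \neq 0$). Let $a = \sum_{i=0}^n a_i b^i$ (base $b$ expansion) be a fixed point of $S_{[c,b]}$. Then: (1) If $b$ is odd, then $c$ is even. (2) If $b$ is even, then $c \equiv \sum_{i=1}^n a_i \pmod 2$.
   Context: A fixed point of $S_{[c,b]}$ is a positive integer $a$ with $S_{[c,b]}(a)=a$. -}

module Defs where

open import Data.Nat using (ℕ; zero; suc; _+_; _*_; _%_; _/_; _≥_; NonZero)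
open import Data.List using (List; []; _∷_; map)
open import Data.Nat.ListAction using (sum)

-- Base-b digits of a, least significant first: [a_0, a_1, ..., a_n].
-- The first argument is fuel; with fuel ≥ a it computes the full expansion
-- (each step divides by b ≥ 2, so a steps suffice). digits 0 = [].
digitsFuel : ℕ → (b : ℕ) → .{{NonZero b}} → ℕ → List ℕ
digitsFuel zero    b zero    = []
digitsFuel zero    b (suc _) = []
digitsFuel (suc f) b zero    = []
digitsFuel (suc f) b (suc k) = (suc k % b) ∷ digitsFuel f b (suc k / b)

digits : (b : ℕ) → .{{NonZero b}} → ℕ → List ℕ
digits b a = digitsFuel a b a

S : (c b : ℕ) → .{{NonZero b}} → ℕ → ℕ
S c b a = c + sum (map (λ d → d * d) (digits b a))

higherDigitSum : (b : ℕ) → .{{NonZero b}} → ℕ → ℕ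
higherDigitSum b a = sumTail (digits b a)
  where
  sumTail : List ℕ → ℕ
  sumTail []       = 0
  sumTail (_ ∷ ds) = sum ds

-- Reduce everything modulo 2 along the semiring homomorphism parity : ℕ → ℤ/2.
-- Since d² ≡ d (mod 2), the fixed-point equation a = c + Σ aᵢ² gives c + Σ aᵢ ≡ a.
-- For odd b we have a ≡ Σ aᵢ, so c ≡ 0; for even b we have a ≡ a₀, so c ≡ Σ_{i≥1} aᵢ.
module Submission where

open import Defs
open import Data.Nat using (ℕ; zero; suc; _≤_; _%_; _/_; _+_; _*_; NonZero; s≤s; parity)
open import Data.Nat.Properties using (≤-refl; ≤-trans; ≤-pred; *-comm)
open import Data.Nat.DivMod using (m≡m%n+[m/n]*n; m/n<m)
open import Data.Nat.ListAction using (sum)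
open import Data.List using (List; []; _∷_; map)
open import Data.Parity.Base as ℙ using (Parity; 0ℙ; 1ℙ)
open import Data.Parity.Properties
  using (+-homo-+; *-homo-*; *-idem; +-identityʳ; +-assoc; +-comm; +-cancelʳ-≡; +-0-group)
open import Algebra.Properties.Group +-0-group using (x∙y⁻¹≈ε⇒x≈y)
open import Data.Product using (_×_; _,_)
open import Relation.Binary.PropositionalEquality
open ≡-Reasoning

fromDigits : ℕ → List ℕ → ℕ
fromDigits b []       = 0
fromDigits b (d ∷ ds) = d + b * fromDigits b ds

fromDigits-digitsFuel : ∀ b .{{_ : NonZero b}} → 2 ≤ b →
                        ∀ f a → a ≤ f → fromDigits b (digitsFuel f b a) ≡ a
fromDigits-digitsFuel b 2≤b zero    zero    _         = refl
fromDigits-digitsFuel b 2≤b (suc f) zero    _         = refl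
fromDigits-digitsFuel b 2≤b (suc f) (suc k) (s≤s k≤f) = begin
  suc k % b + b * fromDigits b (digitsFuel f b (suc k / b))
    ≡⟨ cong (λ n → suc k % b + b * n) (fromDigits-digitsFuel b 2≤b f (suc k / b) k/b≤f) ⟩
  suc k % b + b * (suc k / b)  ≡⟨ cong (suc k % b +_) (*-comm b (suc k / b)) ⟩
  suc k % b + suc k / b * b    ≡⟨ m≡m%n+[m/n]*n (suc k) b ⟨
  suc k                        ∎
  where
  k/b≤f : suc k / b ≤ f
  k/b≤f = ≤-trans (≤-pred (m/n<m (suc k) b 2≤b)) k≤f

fromDigits-digits : ∀ b .{{_ : NonZero b}} → 2 ≤ b → ∀ a → fromDigits b (digits b a) ≡ a
fromDigits-digits b 2≤b a = fromDigits-digitsFuel b 2≤b a a ≤-refl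

toℕ : Parity → ℕ
toℕ 0ℙ = 0
toℕ 1ℙ = 1

%2≡toℕ-parity : ∀ n → n % 2 ≡ toℕ (parity n)
%2≡toℕ-parity zero          = refl
%2≡toℕ-parity (suc zero)    = refl
%2≡toℕ-parity (suc (suc n)) = %2≡toℕ-parity n

parity⇒%2 : ∀ n {p} → parity n ≡ p → n % 2 ≡ toℕ p
parity⇒%2 n eq = trans (%2≡toℕ-parity n) (cong toℕ eq)

%2⇒parity : ∀ n {p} → n % 2 ≡ toℕ p → parity n ≡ p
%2⇒parity n eq = toℕ-injective (trans (sym (%2≡toℕ-parity n)) eq)
  where
  toℕ-injective : ∀ {p q} → toℕ p ≡ toℕ q → p ≡ q
  toℕ-injective {0ℙ} {0ℙ} _ = refl
  toℕ-injective {1ℙ} {1ℙ} _ = refl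

parity-square : ∀ d → parity (d * d) ≡ parity d
parity-square d = trans (*-homo-* d d) (*-idem (parity d))

parity-sum-squares : ∀ ds → parity (sum (map (λ d → d * d) ds)) ≡ parity (sum ds)
parity-sum-squares []       = refl
parity-sum-squares (d ∷ ds) = begin
  parity (d * d + sum (map (λ d → d * d) ds))
    ≡⟨ +-homo-+ (d * d) _ ⟩
  parity (d * d) ℙ.+ parity (sum (map (λ d → d * d) ds))
    ≡⟨ cong₂ ℙ._+_ (parity-square d) (parity-sum-squares ds) ⟩
  parity d ℙ.+ parity (sum ds)
    ≡⟨ +-homo-+ d (sum ds) ⟨
  parity (d + sum ds) ∎

parity-fromDigits-∷ : ∀ b d ds →
  parity (fromDigits b (d ∷ ds)) ≡ parity d ℙ.+ (parity b ℙ.* parity (fromDigits b ds))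
parity-fromDigits-∷ b d ds = begin
  parity (d + b * fromDigits b ds)          ≡⟨ +-homo-+ d _ ⟩
  parity d ℙ.+ parity (b * fromDigits b ds) ≡⟨ cong (parity d ℙ.+_) (*-homo-* b _) ⟩
  parity d ℙ.+ (parity b ℙ.* parity (fromDigits b ds)) ∎

parity-fromDigits-oddBase : ∀ b → parity b ≡ 1ℙ →
                            ∀ ds → parity (fromDigits b ds) ≡ parity (sum ds)
parity-fromDigits-oddBase b b-odd []       = refl
parity-fromDigits-oddBase b b-odd (d ∷ ds) = begin
  parity (fromDigits b (d ∷ ds))
    ≡⟨ parity-fromDigits-∷ b d ds ⟩
  parity d ℙ.+ (parity b ℙ.* parity (fromDigits b ds))
    ≡⟨ cong₂ (λ p q → parity d ℙ.+ (p ℙ.* q)) b-odd (parity-fromDigits-oddBase b b-odd ds) ⟩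
  parity d ℙ.+ parity (sum ds)
    ≡⟨ +-homo-+ d (sum ds) ⟨
  parity (d + sum ds) ∎

parity-fromDigits-evenBase : ∀ b → parity b ≡ 0ℙ →
                             ∀ d ds → parity (fromDigits b (d ∷ ds)) ≡ parity d
parity-fromDigits-evenBase b b-even d ds = begin
  parity (fromDigits b (d ∷ ds))
    ≡⟨ parity-fromDigits-∷ b d ds ⟩
  parity d ℙ.+ (parity b ℙ.* parity (fromDigits b ds))
    ≡⟨ cong (λ p → parity d ℙ.+ (p ℙ.* parity (fromDigits b ds))) b-even ⟩
  parity d ℙ.+ 0ℙ
    ≡⟨ +-identityʳ (parity d) ⟩
  parity d ∎

fixedPoint-parity : ∀ c b .{{_ : NonZero b}} → 2 ≤ b → ∀ a → S c b a ≡ a →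
                    parity c ℙ.+ parity (sum (digits b a)) ≡ parity (fromDigits b (digits b a))
fixedPoint-parity c b 2≤b a fixed = begin
  parity c ℙ.+ parity (sum (digits b a))
    ≡⟨ cong (parity c ℙ.+_) (parity-sum-squares (digits b a)) ⟨
  parity c ℙ.+ parity (sum (map (λ d → d * d) (digits b a)))
    ≡⟨ +-homo-+ c _ ⟨
  parity (S c b a)                           ≡⟨ cong parity fixed ⟩
  parity a                                   ≡⟨ cong parity (fromDigits-digits b 2≤b a) ⟨
  parity (fromDigits b (digits b a))         ∎

oddBase-correction≡0ℙ : ∀ b → parity b ≡ 1ℙ → ∀ p ds →
  p ℙ.+ parity (sum ds) ≡ parity (fromDigits b ds) → p ≡ 0ℙ
oddBase-correction≡0ℙ b b-odd p ds eq =
  +-cancelʳ-≡ (parity (sum ds)) p 0ℙ (trans eq (parity-fromDigits-oddBase b b-odd ds))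

evenBase-correction≡higherDigitSum : ∀ b .{{_ : NonZero b}} → parity b ≡ 0ℙ → ∀ a p →
  p ℙ.+ parity (sum (digits b a)) ≡ parity (fromDigits b (digits b a)) →
  p ≡ parity (higherDigitSum b a)
evenBase-correction≡higherDigitSum b b-even a p eq with digits b a
... | []     = trans (sym (+-identityʳ p)) eq
-- In ℤ/2 every element is its own inverse, so p + s ≡ 0ℙ already means p ≡ s.
... | d ∷ ds = x∙y⁻¹≈ε⇒x≈y p (parity (sum ds)) (+-cancelʳ-≡ (parity d) _ 0ℙ (begin
  p ℙ.+ parity (sum ds) ℙ.+ parity d   ≡⟨ +-assoc p _ _ ⟩
  p ℙ.+ (parity (sum ds) ℙ.+ parity d) ≡⟨ cong (p ℙ.+_) (+-comm _ (parity d)) ⟩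
  p ℙ.+ (parity d ℙ.+ parity (sum ds)) ≡⟨ cong (p ℙ.+_) (+-homo-+ d (sum ds)) ⟨
  p ℙ.+ parity (d + sum ds)            ≡⟨ eq ⟩
  parity (fromDigits b (d ∷ ds))       ≡⟨ parity-fromDigits-evenBase b b-even d ds ⟩
  parity d                             ∎))

lemma2p3 : (c b : ℕ) → .{{_ : NonZero b}} → 2 ≤ b →
    (a : ℕ) → 1 ≤ a → S c b a ≡ a →
    ((b % 2 ≡ 1 → c % 2 ≡ 0) ×
     (b % 2 ≡ 0 → c % 2 ≡ higherDigitSum b a % 2))
lemma2p3 c b 2≤b a _ fixed = oddBase , evenBase
  where
  correction : parity c ℙ.+ parity (sum (digits b a)) ≡ parity (fromDigits b (digits b a))
  correction = fixedPoint-parity c b 2≤b a fixed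

  oddBase : b % 2 ≡ 1 → c % 2 ≡ 0
  oddBase b-odd = parity⇒%2 c
    (oddBase-correction≡0ℙ b (%2⇒parity b b-odd) (parity c) (digits b a) correction)

  evenBase : b % 2 ≡ 0 → c % 2 ≡ higherDigitSum b a % 2
  evenBase b-even = trans (parity⇒%2 c c≡h) (sym (parity⇒%2 (higherDigitSum b a) refl))
    where
    c≡h : parity c ≡ parity (higherDigitSum b a)
    c≡h = evenBase-correction≡higherDigitSum b (%2⇒parity b b-even) a (parity c) correction
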